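{- Fix a real $\delta$ with $0<\delta<1/2$ and, for each $n$ with $\delta n\in\mathbb{Z}$, let $d=\delta n$. For integers $s,t,m,r$ define $$g(s,t,m,r)=\binom{n}{s}D_s\binom{s}{m}\binom{m}{r}\binom{n-s}{t-m}(t-r)!.$$ Then for every real $\varepsilon$ with $0<\varepsilon<1/6$ and all sufficiently large $n$ (with $\delta n$ an integer), every quadruple of integers $s,t,m,r$ satisfying $$1\le s\le d,\quad 1\le t\le d,\quad \left\lceil\tfrac{s+t-d}{2}\right\rceil^+\le m\le\min\{s,t\},\quad \lceil s+t-m-d\rceil^+\le r\le m$$ satisfies $$\log_2\!\left(\frac{g(d,d,d,0)}{g(s,t,m,r)}\right)\;\ge\;-3n\,h_2(3\varepsilon).$$
   Context: $D_k$ denotes the number of derangements (fixed-point-free permutations) of $k$ elements, with $D_0=1$. For real $x$, $\lceil x\rceil^+$ denotes the smallest nonnegative integer $k$ with $k\ge x$. $h_2(x)=-x\log_2 x-(1-x)\log_2(1-x)$ is the binary entropy function.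
   Formalization: The parameters δ and ε range over the rationals rather than the reals. -}

module Defs where

open import Data.Nat using (ℕ; zero; suc; _+_; _*_; _∸_; _/_; _!)
open import Data.Nat.Combinatorics using (_C_)
open import Data.Fin using (Fin)
open import Data.Fin.Properties using (all?) renaming (_≟_ to _≟ᶠ_)
open import Data.Vec using (Vec; []; _∷_; lookup)
open import Data.List using (List; [_]; map; concatMap; filter; length)
open import Data.List.Base using (allFin)
open import Data.Product using (_×_)
open import Relation.Binary.PropositionalEquality using (_≡_; _≢_)
open import Relation.Nullary using (Dec; ¬_)
open import Relation.Nullary.Decidable using (_×-dec_; _→-dec_; ¬?)

allVecs : (k m : ℕ) → List (Vec (Fin k) m)
allVecs k zero    = [ [] ]
allVecs k (suc m) = concatMap (λ x → map (x ∷_) (allVecs k m)) (allFin k)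

IsDerangement : {k : ℕ} → Vec (Fin k) k → Set
IsDerangement {k} v =
  ((i j : Fin k) → lookup v i ≡ lookup v j → i ≡ j) × ((i : Fin k) → lookup v i ≢ i)

isDerangement? : {k : ℕ} → (v : Vec (Fin k) k) → Dec (IsDerangement v)
isDerangement? v =
  all? (λ i → all? (λ j → (lookup v i ≟ᶠ lookup v j) →-dec (i ≟ᶠ j)))
  ×-dec all? (λ i → ¬? (lookup v i ≟ᶠ i))

D : ℕ → ℕ
D k = length (filter isDerangement? (allVecs k k))

-- g(s,t,m,r) = C(n,s) D_s C(s,m) C(m,r) C(n-s,t-m) (t-r)!
-- (only used where s ≤ n, m ≤ t, r ≤ t, so truncated subtraction is exact)
g : (n s t m r : ℕ) → ℕ
g n s t m r = (n C s) * D s * (s C m) * (m C r) * ((n ∸ s) C (t ∸ m)) * ((t ∸ r) !)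

-- ⌈ x / 2 ⌉⁺ for x = s + t - d : the smallest nonnegative integer ≥ (s+t-d)/2.
ceilHalf⁺ : (s t d : ℕ) → ℕ
ceilHalf⁺ s t d = suc ((s + t) ∸ d) / 2

-- ⌈ s + t - m - d ⌉⁺ (an integer, so the ceiling is the positive part).
ceilPos : (s t m d : ℕ) → ℕ
ceilPos s t m d = (s + t) ∸ (m + d)

module Submission where

-- Put a = t ∸ m, b = s ∸ m and k = ⌈s + t − m − d⌉⁺, so that k ≤ min(a, b, r). Clearing the
-- factorials of the binomial coefficients and using that D_s/(s−1)! is nondecreasing (a
-- derangement of s points extends to one of s + 1 points in s ways) gives
-- g(s,t,m,r)·(k!)³ ≤ g(d,d,d,0)·n^(2k+1). As n^(2k+1)/(k!)³ ≤ 2^O(n^(2/3) log n), for large n the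
-- ratio g(s,t,m,r)/g(d,d,d,0) is at most 2^(n/q), and n/q ≤ 3n·h₂(3p/q) because q·h₂(3p/q) ≥ 1.

open import Data.Fin using (Fin; zero; suc; _≟_)
open import Data.Fin.Properties using (suc-injective)
open import Data.List using (List; []; _∷_; _++_; map; concatMap; filter; length; cartesianProductWith; allFin)
open import Data.List.Membership.Propositional using (_∈_)
open import Data.List.Membership.Propositional.Properties
  using ( ∈-∃++; ∈-++⁻; ∈-++⁺ˡ; ∈-++⁺ʳ; ∈-cartesianProductWith⁺; ∈-cartesianProductWith⁻
        ; ∈-filter⁺; ∈-filter⁻; ∈-allFin)
open import Data.List.Properties using (length-++; length-map; length-tabulate)
open import Data.List.Relation.Binary.Subset.Propositional using (_⊆_)
import Data.List.Relation.Unary.All as All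
open import Data.List.Relation.Unary.AllPairs using ([]; _∷_)
open import Data.List.Relation.Unary.Any using (here; there)
open import Data.List.Relation.Unary.Unique.Propositional using (Unique)
open import Data.List.Relation.Unary.Unique.Propositional.Properties using (cartesianProductWith⁺; filter⁺; allFin⁺)
open import Data.Nat
  using ( ℕ; zero; suc; _+_; _*_; _∸_; _^_; _≤_; _<_; _⊓_; _!; _≤?_; z≤n; s≤s
        ; _≤′_; ≤′-refl; ≤′-step; NonZero; >-nonZero)
open import Data.Nat.Combinatorics using (_C_; nCk≡n!/k![n-k]!; k![n∸k]!∣n!; nCn≡1)
open import Data.Nat.DivMod using (_/_; m/n*n≡m)
open import Data.Nat.Properties hiding (_≟_; suc-injective)
open import Algebra.Properties.CommutativeSemigroup *-commutativeSemigroup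
  using (x∙yz≈y∙xz; x∙yz≈xz∙y; xy∙z≈xz∙y; xy∙z≈zx∙y; interchange)
open import Data.Nat.Tactic.RingSolver using (solve-∀)
open import Data.Product using (Σ; _×_; _,_; proj₂; map₁; ∃-syntax)
open import Data.Sum using (inj₁; inj₂)
open import Data.Vec using (Vec; []; _∷_; lookup; tabulate)
open import Data.Vec.Properties using (lookup∘tabulate; tabulate∘lookup; tabulate-cong; ∷-injective)
open import Function using (Injective; _∘_)
open import Relation.Binary.PropositionalEquality
open import Relation.Nullary using (yes; no; contradiction)

open import Defs

module _ {a} {A : Set a} where

  unique-⊆⇒length≤ : {xs ys : List A} → Unique xs → xs ⊆ ys → length xs ≤ length ys
  unique-⊆⇒length≤ {[]}     _            _     = z≤n
  unique-⊆⇒length≤ {x ∷ xs} (x∉xs ∷ xs!) xs⊆ys with us , vs , refl ← ∈-∃++ (xs⊆ys (here refl)) =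
    ≤-trans (s≤s (unique-⊆⇒length≤ xs! xs⊆us++vs)) (≤-reflexive length-us++vs)
    where
    xs⊆us++vs : xs ⊆ us ++ vs
    xs⊆us++vs z∈xs with ∈-++⁻ us (xs⊆ys (there z∈xs))
    ... | inj₁ z∈us         = ∈-++⁺ˡ z∈us
    ... | inj₂ (here refl)  = contradiction refl (All.lookup x∉xs z∈xs)
    ... | inj₂ (there z∈vs) = ∈-++⁺ʳ us z∈vs
    length-us++vs : suc (length (us ++ vs)) ≡ length (us ++ x ∷ vs)
    length-us++vs = begin
      suc (length (us ++ vs))           ≡⟨ cong suc (length-++ us) ⟩
      suc (length us + length vs)       ≡⟨ +-suc (length us) (length vs) ⟨
      length us + length (x ∷ vs)       ≡⟨ length-++ us ⟨
      length (us ++ x ∷ vs)             ∎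
      where open ≡-Reasoning

module _ {a b c} {A : Set a} {B : Set b} {C : Set c} (f : A → B → C) where

  concatMap-map≡cartesianProductWith : ∀ xs ys → concatMap (λ x → map (f x) ys) xs ≡ cartesianProductWith f xs ys
  concatMap-map≡cartesianProductWith []       ys = refl
  concatMap-map≡cartesianProductWith (x ∷ xs) ys = cong (map (f x) ys ++_) (concatMap-map≡cartesianProductWith xs ys)

  length-cartesianProductWith : ∀ xs ys → length (cartesianProductWith f xs ys) ≡ length xs * length ys
  length-cartesianProductWith []       ys = refl
  length-cartesianProductWith (x ∷ xs) ys = begin
    length (map (f x) ys ++ cartesianProductWith f xs ys) ≡⟨ length-++ (map (f x) ys) ⟩
    length (map (f x) ys) + length (cartesianProductWith f xs ys)
      ≡⟨ cong₂ _+_ (length-map (f x) ys) (length-cartesianProductWith xs ys) ⟩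
    length ys + length xs * length ys ∎
    where open ≡-Reasoning

allVecs-suc : ∀ k m → allVecs k (suc m) ≡ cartesianProductWith _∷_ (allFin k) (allVecs k m)
allVecs-suc k m = concatMap-map≡cartesianProductWith _∷_ (allFin k) (allVecs k m)

∈-allVecs : ∀ {k m} (v : Vec (Fin k) m) → v ∈ allVecs k m
∈-allVecs {k} {zero}  []      = here refl
∈-allVecs {k} {suc m} (x ∷ v) rewrite allVecs-suc k m = ∈-cartesianProductWith⁺ _∷_ (∈-allFin x) (∈-allVecs v)

allVecs-unique : ∀ k m → Unique (allVecs k m)
allVecs-unique k zero    = All.[] ∷ []
allVecs-unique k (suc m) rewrite allVecs-suc k m =
  cartesianProductWith⁺ _∷_ ∷-injective (allFin⁺ k) (allVecs-unique k m)

tabulate-isDerangement : ∀ {k} {h : Fin k → Fin k} →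
  Injective _≡_ _≡_ h → (∀ x → h x ≢ x) → IsDerangement (tabulate h)
tabulate-isDerangement {h = h} h-inj h-fpf =
  (λ i j eq → h-inj (trans (sym (lookup∘tabulate h i)) (trans eq (lookup∘tabulate h j)))) ,
  (λ i → h-fpf i ∘ trans (sym (lookup∘tabulate h i)))

module _ {k : ℕ} where

  -- Splices the new point zero into the cycle of f through i, between i and f i.
  insertAfter : (Fin k → Fin k) → Fin k → Fin (suc k) → Fin (suc k)
  insertAfter f i zero    = suc (f i)
  insertAfter f i (suc j) with j ≟ i
  ... | yes _ = zero
  ... | no  _ = suc (f j)

  insertAfter-self : ∀ f i → insertAfter f i (suc i) ≡ zero
  insertAfter-self f i with i ≟ i
  ... | yes _   = refl
  ... | no  i≢i = contradiction refl i≢i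

  insertAfter≡zero : ∀ {f i j} → insertAfter f i (suc j) ≡ zero → j ≡ i
  insertAfter≡zero {f} {i} {j} eq with j ≟ i
  ... | yes j≡i = j≡i
  ... | no  _   = contradiction eq λ ()

  insertAfter-injective : ∀ {f i} → Injective _≡_ _≡_ f → Injective _≡_ _≡_ (insertAfter f i)
  insertAfter-injective {f} {i} f-inj {zero}  {zero}   _  = refl
  insertAfter-injective {f} {i} f-inj {zero}  {suc j}  eq with j ≟ i
  ... | yes _   = contradiction eq λ ()
  ... | no  j≢i = contradiction (f-inj (suc-injective eq)) (j≢i ∘ sym)
  insertAfter-injective {f} {i} f-inj {suc j} {zero}   eq with j ≟ i
  ... | yes _   = contradiction eq λ ()
  ... | no  j≢i = contradiction (f-inj (suc-injective eq)) j≢i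
  insertAfter-injective {f} {i} f-inj {suc j} {suc j′} eq with j ≟ i | j′ ≟ i
  ... | yes j≡i | yes j′≡i = cong suc (trans j≡i (sym j′≡i))
  ... | yes _   | no  _    = contradiction eq λ ()
  ... | no  _   | yes _    = contradiction eq λ ()
  ... | no  _   | no  _    = cong suc (f-inj (suc-injective eq))

  insertAfter-fixedPointFree : ∀ {f i} → (∀ j → f j ≢ j) → ∀ x → insertAfter f i x ≢ x
  insertAfter-fixedPointFree {f} {i} f-fpf zero    ()
  insertAfter-fixedPointFree {f} {i} f-fpf (suc j) with j ≟ i
  ... | yes _ = λ ()
  ... | no  _ = f-fpf j ∘ suc-injective

  insertAfter-cancel : ∀ {f f′ i i′} → insertAfter f i ≗ insertAfter f′ i′ → f ≗ f′ × i ≡ i′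
  insertAfter-cancel {f} {f′} {i} {i′} eq
    with refl ← insertAfter≡zero (trans (sym (eq (suc i))) (insertAfter-self f i)) = f≗f′ , refl
    where
    f≗f′ : f ≗ f′
    f≗f′ j with j ≟ i | eq (suc j)
    ... | yes refl | _          = suc-injective (eq zero)
    ... | no  _    | f[j]≡f′[j] = suc-injective f[j]≡f′[j]

  extend : Vec (Fin k) k → Fin k → Vec (Fin (suc k)) (suc k)
  extend σ i = tabulate (insertAfter (lookup σ) i)

  extend-isDerangement : ∀ σ i → IsDerangement σ → IsDerangement (extend σ i)
  extend-isDerangement σ i (σ-inj , σ-fpf) =
    tabulate-isDerangement (insertAfter-injective (σ-inj _ _)) (insertAfter-fixedPointFree σ-fpf)

  extend-injective : ∀ {σ σ′ i i′} → extend σ i ≡ extend σ′ i′ → σ ≡ σ′ × i ≡ i′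
  extend-injective {σ} {σ′} {i} {i′} eq = map₁ lookup-ext (insertAfter-cancel pointwise)
    where
    pointwise : insertAfter (lookup σ) i ≗ insertAfter (lookup σ′) i′
    pointwise x = trans (sym (lookup∘tabulate (insertAfter (lookup σ) i) x))
      (trans (cong (λ v → lookup v x) eq) (lookup∘tabulate (insertAfter (lookup σ′) i′) x))
    lookup-ext : lookup σ ≗ lookup σ′ → σ ≡ σ′
    lookup-ext σ≗σ′ = trans (sym (tabulate∘lookup σ)) (trans (tabulate-cong σ≗σ′) (tabulate∘lookup σ′))

derangements : (k : ℕ) → List (Vec (Fin k) k)
derangements k = filter isDerangement? (allVecs k k)

D[n]*n≤D[1+n] : ∀ n → D n * n ≤ D (suc n)
D[n]*n≤D[1+n] n = begin
  D n * n                                           ≡⟨ cong (D n *_) (length-tabulate {n = n} (λ i → i)) ⟨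
  length (derangements n) * length (allFin n)       ≡⟨ length-cartesianProductWith extend (derangements n) (allFin n) ⟨
  length extensions                                 ≤⟨ unique-⊆⇒length≤ extensions-unique extensions⊆derangements ⟩
  D (suc n)                                         ∎
  where
  open ≤-Reasoning
  extensions = cartesianProductWith extend (derangements n) (allFin n)
  extensions-unique : Unique extensions
  extensions-unique = cartesianProductWith⁺ extend extend-injective
    (filter⁺ isDerangement? (allVecs-unique n n)) (allFin⁺ n)
  extensions⊆derangements : extensions ⊆ derangements (suc n)
  extensions⊆derangements ρ∈
    with σ , i , σ∈ , _ , refl ← ∈-cartesianProductWith⁻ extend (derangements n) (allFin n) ρ∈ =
    ∈-filter⁺ isDerangement? (∈-allVecs (extend σ i))
      (extend-isDerangement σ i (proj₂ (∈-filter⁻ isDerangement? {xs = allVecs n n} σ∈)))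

D[1+m]*n!≤D[1+n]*m! : ∀ {m n} → m ≤ n → D (suc m) * n ! ≤ D (suc n) * m !
D[1+m]*n!≤D[1+n]*m! {m} m≤n = go (≤⇒≤′ m≤n)
  where
  open ≤-Reasoning
  go : ∀ {n} → m ≤′ n → D (suc m) * n ! ≤ D (suc n) * m !
  go ≤′-refl = ≤-refl
  go {suc n} (≤′-step m≤′n) = begin
    D (suc m) * (suc n * n !)   ≡⟨ x∙yz≈xz∙y (D (suc m)) (suc n) (n !) ⟩
    D (suc m) * n ! * suc n     ≤⟨ *-monoˡ-≤ (suc n) (go m≤′n) ⟩
    D (suc n) * m ! * suc n     ≡⟨ xy∙z≈xz∙y (D (suc n)) (m !) (suc n) ⟩
    D (suc n) * suc n * m !     ≤⟨ *-monoˡ-≤ (m !) (D[n]*n≤D[1+n] (suc n)) ⟩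
    D (suc (suc n)) * m !       ∎

m∸o≤[m∸n]+[n∸o] : ∀ m n o → m ∸ o ≤ (m ∸ n) + (n ∸ o)
m∸o≤[m∸n]+[n∸o] m n o = m≤n+o⇒m∸n≤o m o (begin
  m                               ≤⟨ m≤n+m∸n m n ⟩
  n + (m ∸ n)                     ≤⟨ +-monoˡ-≤ (m ∸ n) (m≤n+m∸n n o) ⟩
  o + (n ∸ o) + (m ∸ n)           ≡⟨ x+y+z≡x+[z+y] o (n ∸ o) (m ∸ n) ⟩
  o + ((m ∸ n) + (n ∸ o))         ∎)
  where
  open ≤-Reasoning
  x+y+z≡x+[z+y] : ∀ x y z → x + y + z ≡ x + (z + y)
  x+y+z≡x+[z+y] = solve-∀

[x+y]∸[m+d]≡[x+[y∸m]]∸d : ∀ x {y} m d → m ≤ y → (x + y) ∸ (m + d) ≡ (x + (y ∸ m)) ∸ d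
[x+y]∸[m+d]≡[x+[y∸m]]∸d x {y} m d m≤y =
  trans (sym (∸-+-assoc (x + y) m d)) (cong (_∸ d) (+-∸-assoc x m≤y))

[n∸m]+[o∸n]≡o∸m : ∀ {m n o} → m ≤ n → n ≤ o → (n ∸ m) + (o ∸ n) ≡ o ∸ m
[n∸m]+[o∸n]≡o∸m {zero}  {n}     {o}     _         n≤o       = m+[n∸m]≡n n≤o
[n∸m]+[o∸n]≡o∸m {suc m} {suc n} {suc o} (s≤s m≤n) (s≤s n≤o) = [n∸m]+[o∸n]≡o∸m m≤n n≤o

!-mono-≤ : ∀ {m n} → m ≤ n → m ! ≤ n !
!-mono-≤ {m} m≤n = go (≤⇒≤′ m≤n)
  where
  go : ∀ {n} → m ≤′ n → m ! ≤ n !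
  go ≤′-refl          = ≤-refl
  go {suc n} (≤′-step m≤′n) = ≤-trans (go m≤′n) (m≤m+n (n !) (n * n !))

m!≤n!*o^j : ∀ {m n o} j → .{{NonZero o}} → m ≤ n + j → m ≤ o → m ! ≤ n ! * o ^ j
m!≤n!*o^j {m} {n} {o} zero    m≤n+0 _ = begin
  m !        ≤⟨ !-mono-≤ (≤-trans m≤n+0 (≤-reflexive (+-identityʳ n))) ⟩
  n !        ≡⟨ *-identityʳ (n !) ⟨
  n ! * 1    ∎
  where open ≤-Reasoning
m!≤n!*o^j {zero}  {n} {o} (suc j) _ _ = *-mono-≤ (1≤n! n) (m^n>0 o (suc j))
m!≤n!*o^j {suc m} {n} {o} (suc j) 1+m≤n+1+j 1+m≤o = begin
  suc m * m !              ≤⟨ *-mono-≤ 1+m≤o (m!≤n!*o^j j m≤n+j (≤-trans (n≤1+n m) 1+m≤o)) ⟩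
  o * (n ! * o ^ j)        ≡⟨ x∙yz≈y∙xz o (n !) (o ^ j) ⟩
  n ! * (o * o ^ j)        ∎
  where
  open ≤-Reasoning
  m≤n+j : m ≤ n + j
  m≤n+j = ≤-pred (≤-trans 1+m≤n+1+j (≤-reflexive (+-suc n j)))

-- In factorial form, this is the monotonicity of the binomial coefficient C(n, a) in n.
[m+a]!*[n∸a]!≤n!*m! : ∀ m a {n} → m + a ≤ n → (m + a) ! * (n ∸ a) ! ≤ n ! * m !
[m+a]!*[n∸a]!≤n!*m! m a m+a≤n = go (≤⇒≤′ m+a≤n)
  where
  open ≤-Reasoning
  go : ∀ {n} → m + a ≤′ n → (m + a) ! * (n ∸ a) ! ≤ n ! * m !
  go ≤′-refl = ≤-reflexive (cong (λ x → (m + a) ! * x !) (m+n∸n≡m m a))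
  go {suc n} (≤′-step m+a≤′n) = begin
    (m + a) ! * (suc n ∸ a) !                 ≡⟨ cong (λ x → (m + a) ! * x !) (+-∸-assoc 1 a≤n) ⟩
    (m + a) ! * (suc (n ∸ a) * (n ∸ a) !)     ≡⟨ x∙yz≈xz∙y ((m + a) !) (suc (n ∸ a)) ((n ∸ a) !) ⟩
    (m + a) ! * (n ∸ a) ! * suc (n ∸ a)       ≤⟨ *-mono-≤ (go m+a≤′n) (s≤s (m∸n≤m n a)) ⟩
    n ! * m ! * suc n                         ≡⟨ xy∙z≈zx∙y (n !) (m !) (suc n) ⟩
    suc n * n ! * m !                         ∎
    where
    a≤n : a ≤ n
    a≤n = ≤-trans (m≤n+m a m) (≤′⇒≤ m+a≤′n)

nCk*[k!*[n∸k]!]≡n! : ∀ {n k} → k ≤ n → (n C k) * (k ! * (n ∸ k) !) ≡ n !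
nCk*[k!*[n∸k]!]≡n! {n} {k} k≤n = begin
  (n C k) * (k ! * (n ∸ k) !)                         ≡⟨ cong (_* (k ! * (n ∸ k) !)) (nCk≡n!/k![n-k]! k≤n) ⟩
  (n ! / (k ! * (n ∸ k) !)) * (k ! * (n ∸ k) !)       ≡⟨ m/n*n≡m (k![n∸k]!∣n! k≤n) ⟩
  n !                                                 ∎
  where
  open ≡-Reasoning
  instance _ = k !* (n ∸ k) !≢0

g-denominator : (n s t m r : ℕ) → ℕ
g-denominator n s t m r = (s ∸ m) ! * r ! * (m ∸ r) ! * (t ∸ m) ! * (n ∸ s ∸ (t ∸ m)) !

g-closed : ∀ {n s t m r} → s ≤ n → m ≤ s → r ≤ m → t ∸ m ≤ n ∸ s →
  g n s t m r * g-denominator n s t m r ≡ n ! * D s * (t ∸ r) !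
g-closed {n} {s} {t} {m} {r} s≤n m≤s r≤m a≤n∸s = begin
  g n s t m r * ((s ∸ m) ! * r ! * (m ∸ r) ! * a ! * (n ∸ s ∸ a) !)
    ≡⟨ regroup (n C s) (D s) (s C m) (m C r) ((n ∸ s) C a) ((t ∸ r) !)
               ((s ∸ m) !) (r !) ((m ∸ r) !) (a !) ((n ∸ s ∸ a) !) ⟩
  (n C s) * D s * (t ∸ r) ! * ((s C m) * ((m C r) * (r ! * (m ∸ r) !) * (s ∸ m) !))
    * (((n ∸ s) C a) * (a ! * (n ∸ s ∸ a) !))
    ≡⟨ cong₂ (λ x y → (n C s) * D s * (t ∸ r) ! * ((s C m) * (x * (s ∸ m) !)) * y)
         (nCk*[k!*[n∸k]!]≡n! r≤m) (nCk*[k!*[n∸k]!]≡n! a≤n∸s) ⟩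
  (n C s) * D s * (t ∸ r) ! * ((s C m) * (m ! * (s ∸ m) !)) * (n ∸ s) !
    ≡⟨ cong (λ x → (n C s) * D s * (t ∸ r) ! * x * (n ∸ s) !) (nCk*[k!*[n∸k]!]≡n! m≤s) ⟩
  (n C s) * D s * (t ∸ r) ! * s ! * (n ∸ s) !
    ≡⟨ regroup′ (n C s) (D s) ((t ∸ r) !) (s !) ((n ∸ s) !) ⟩
  (n C s) * (s ! * (n ∸ s) !) * D s * (t ∸ r) !
    ≡⟨ cong (λ x → x * D s * (t ∸ r) !) (nCk*[k!*[n∸k]!]≡n! s≤n) ⟩
  n ! * D s * (t ∸ r) !
    ∎
  where
  open ≡-Reasoning
  a = t ∸ m
  regroup : ∀ ns ds sm mr nsa tr b! r! mr! a! nsa! →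
    ns * ds * sm * mr * nsa * tr * (b! * r! * mr! * a! * nsa!) ≡
    ns * ds * tr * (sm * (mr * (r! * mr!) * b!)) * (nsa * (a! * nsa!))
  regroup = solve-∀
  regroup′ : ∀ ns ds tr s! ns! → ns * ds * tr * s! * ns! ≡ ns * (s! * ns!) * ds * tr
  regroup′ = solve-∀

g-diagonal : ∀ {n d} → d ≤ n → g n d d d 0 * (n ∸ d) ! ≡ n ! * D d
g-diagonal {n} {d} d≤n rewrite nCn≡1 d | n∸n≡0 d = begin
  (n C d) * D d * 1 * 1 * 1 * d ! * (n ∸ d) !   ≡⟨ regroup (n C d) (D d) (d !) ((n ∸ d) !) ⟩
  (n C d) * (d ! * (n ∸ d) !) * D d             ≡⟨ cong (_* D d) (nCk*[k!*[n∸k]!]≡n! d≤n) ⟩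
  n ! * D d                                     ∎
  where
  open ≡-Reasoning
  regroup : ∀ nd dd d! nd! → nd * dd * 1 * 1 * 1 * d! * nd! ≡ nd * (d! * nd!) * dd
  regroup = solve-∀

x^k*x^[1+k]≡x^[1+2k] : ∀ x k → x ^ k * x ^ suc k ≡ x ^ suc (2 * k)
x^k*x^[1+k]≡x^[1+2k] x k = begin
  x ^ k * (x * x ^ k)     ≡⟨ x∙yz≈y∙xz (x ^ k) x (x ^ k) ⟩
  x * (x ^ k * x ^ k)     ≡⟨ cong (x *_) (^-distribˡ-+-* x k k) ⟨
  x * x ^ (k + k)         ≡⟨ cong (λ j → x * x ^ (k + j)) (+-identityʳ k) ⟨
  x * x ^ (2 * k)         ∎
  where open ≡-Reasoning

module Estimate {n s′ t m r d′ : ℕ}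
  (s≤d : suc s′ ≤ suc d′) (t≤d : t ≤ suc d′) (m≤s : m ≤ suc s′) (m≤t : m ≤ t) (r≤m : r ≤ m)
  (k≤r : (suc s′ + t) ∸ (m + suc d′) ≤ r) (s+t≤n : suc s′ + t ≤ n) (d≤n : suc d′ ≤ n)
  where

  private
    s d a b k B : ℕ
    s = suc s′
    d = suc d′
    a = t ∸ m
    b = s ∸ m
    k = (s + t) ∸ (m + d)
    B = g-denominator n s t m r

    instance
      n≢0 : NonZero n
      n≢0 = >-nonZero (≤-trans (s≤s z≤n) d≤n)

    x*[y*z*w]≡x*y*z*w : ∀ x y z w → x * (y * z * w) ≡ x * y * z * w
    x*[y*z*w]≡x*y*z*w = solve-∀

  open ≤-Reasoning

  k≡[s+a]∸d : k ≡ (s + a) ∸ d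
  k≡[s+a]∸d = [x+y]∸[m+d]≡[x+[y∸m]]∸d s m d m≤t

  k≤a : k ≤ a
  k≤a = begin
    k             ≡⟨ k≡[s+a]∸d ⟩
    (s + a) ∸ d   ≤⟨ m≤n+o⇒m∸n≤o (s + a) d (+-monoˡ-≤ a s≤d) ⟩
    a             ∎

  k≤b : k ≤ b
  k≤b = begin
    k                    ≡⟨ cong (_∸ (m + d)) (+-comm s t) ⟩
    (t + s) ∸ (m + d)    ≡⟨ [x+y]∸[m+d]≡[x+[y∸m]]∸d t m d m≤s ⟩
    (t + b) ∸ d          ≤⟨ m≤n+o⇒m∸n≤o (t + b) d (+-monoˡ-≤ b t≤d) ⟩
    b                    ∎

  [n∸d]!≤[n∸s∸a]!*n^k : (n ∸ d) ! ≤ (n ∸ s ∸ a) ! * n ^ k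
  [n∸d]!≤[n∸s∸a]!*n^k = m!≤n!*o^j k n∸d≤[n∸s∸a]+k (m∸n≤m n d)
    where
    n∸d≤[n∸s∸a]+k : n ∸ d ≤ (n ∸ s ∸ a) + k
    n∸d≤[n∸s∸a]+k = begin
      n ∸ d                           ≤⟨ m∸o≤[m∸n]+[n∸o] n (s + a) d ⟩
      n ∸ (s + a) + ((s + a) ∸ d)     ≡⟨ cong₂ _+_ (∸-+-assoc n s a) k≡[s+a]∸d ⟨
      (n ∸ s ∸ a) + k                 ∎

  s′!≤[d∸a]!*n^k : s′ ! ≤ (d ∸ a) ! * n ^ k
  s′!≤[d∸a]!*n^k = m!≤n!*o^j k s′≤[d∸a]+k (≤-trans (n≤1+n s′) (≤-trans (m≤m+n s t) s+t≤n))
    where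
    s′≤[d∸a]+k : s′ ≤ (d ∸ a) + k
    s′≤[d∸a]+k = begin
      s′                              ≤⟨ n≤1+n s′ ⟩
      s                               ≡⟨ m+n∸n≡m s a ⟨
      (s + a) ∸ a                     ≤⟨ m∸o≤[m∸n]+[n∸o] (s + a) d a ⟩
      ((s + a) ∸ d) + (d ∸ a)         ≡⟨ cong (_+ (d ∸ a)) k≡[s+a]∸d ⟨
      k + (d ∸ a)                     ≡⟨ +-comm k (d ∸ a) ⟩
      (d ∸ a) + k                     ∎

  [t∸r]!*[d∸a]!≤d!*[m∸r]! : (t ∸ r) ! * (d ∸ a) ! ≤ d ! * (m ∸ r) !
  [t∸r]!*[d∸a]!≤d!*[m∸r]! =
    subst (λ x → x ! * (d ∸ a) ! ≤ d ! * (m ∸ r) !) [m∸r]+a≡t∸r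
      ([m+a]!*[n∸a]!≤n!*m! (m ∸ r) a (≤-trans (≤-reflexive [m∸r]+a≡t∸r) (≤-trans (m∸n≤m t r) t≤d)))
    where
    [m∸r]+a≡t∸r : (m ∸ r) + a ≡ t ∸ r
    [m∸r]+a≡t∸r = [n∸m]+[o∸n]≡o∸m r≤m m≤t

  s′!*[t∸r]!≤n^[1+k]*[m∸r]!*d′! : s′ ! * (t ∸ r) ! ≤ n ^ suc k * (m ∸ r) ! * d′ !
  s′!*[t∸r]!≤n^[1+k]*[m∸r]!*d′! = *-cancelʳ-≤ _ _ ((d ∸ a) !) {{(d ∸ a) !≢0}} (begin
    s′ ! * (t ∸ r) ! * (d ∸ a) !                      ≡⟨ *-assoc (s′ !) ((t ∸ r) !) ((d ∸ a) !) ⟩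
    s′ ! * ((t ∸ r) ! * (d ∸ a) !)                    ≤⟨ *-mono-≤ s′!≤[d∸a]!*n^k [t∸r]!*[d∸a]!≤d!*[m∸r]! ⟩
    (d ∸ a) ! * n ^ k * (d ! * (m ∸ r) !)             ≤⟨ *-monoʳ-≤ ((d ∸ a) ! * n ^ k) (*-monoˡ-≤ ((m ∸ r) !) d!≤n*d′!) ⟩
    (d ∸ a) ! * n ^ k * (n * d′ ! * (m ∸ r) !)        ≡⟨ x*y*[z*w*v]≡z*y*v*w*x ((d ∸ a) !) (n ^ k) n (d′ !) ((m ∸ r) !) ⟩
    n * n ^ k * (m ∸ r) ! * d′ ! * (d ∸ a) !          ∎)
    where
    d!≤n*d′! : d ! ≤ n * d′ !
    d!≤n*d′! = *-monoˡ-≤ (d′ !) d≤n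
    x*y*[z*w*v]≡z*y*v*w*x : ∀ x y z w v → x * y * (z * w * v) ≡ z * y * v * w * x
    x*y*[z*w*v]≡z*y*v*w*x = solve-∀

  D[s]*[t∸r]!≤D[d]*n^[1+k]*[m∸r]! : D s * (t ∸ r) ! ≤ D d * n ^ suc k * (m ∸ r) !
  D[s]*[t∸r]!≤D[d]*n^[1+k]*[m∸r]! = *-cancelʳ-≤ _ _ (d′ !) {{d′ !≢0}} (begin
    D s * (t ∸ r) ! * d′ !                     ≡⟨ xy∙z≈xz∙y (D s) ((t ∸ r) !) (d′ !) ⟩
    D s * d′ ! * (t ∸ r) !                     ≤⟨ *-monoˡ-≤ ((t ∸ r) !) (D[1+m]*n!≤D[1+n]*m! (≤-pred s≤d)) ⟩
    D d * s′ ! * (t ∸ r) !                     ≡⟨ *-assoc (D d) (s′ !) ((t ∸ r) !) ⟩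
    D d * (s′ ! * (t ∸ r) !)                   ≤⟨ *-monoʳ-≤ (D d) s′!*[t∸r]!≤n^[1+k]*[m∸r]!*d′! ⟩
    D d * (n ^ suc k * (m ∸ r) ! * d′ !)       ≡⟨ x*[y*z*w]≡x*y*z*w (D d) (n ^ suc k) ((m ∸ r) !) (d′ !) ⟩
    D d * n ^ suc k * (m ∸ r) ! * d′ !         ∎)

  -- g*k!^3≤G*n^[1+2k] below, multiplied through by B·(n ∸ d)! (see g-closed and g-diagonal).
  cleared : (n ∸ d) ! * (D s * (t ∸ r) !) * (k !) ^ 3 ≤ D d * n ^ suc (2 * k) * g-denominator n s t m r
  cleared = begin
    (n ∸ d) ! * (D s * (t ∸ r) !) * (k !) ^ 3
      ≤⟨ *-mono-≤ (*-mono-≤ [n∸d]!≤[n∸s∸a]!*n^k D[s]*[t∸r]!≤D[d]*n^[1+k]*[m∸r]!) k!^3≤a!*b!*r! ⟩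
    (n ∸ s ∸ a) ! * n ^ k * (D d * n ^ suc k * (m ∸ r) !) * (a ! * (b ! * (r ! * 1)))
      ≡⟨ regroup ((n ∸ s ∸ a) !) (n ^ k) (D d) (n ^ suc k) ((m ∸ r) !) (a !) (b !) (r !) ⟩
    D d * (n ^ k * n ^ suc k) * B
      ≡⟨ cong (λ x → D d * x * B) (x^k*x^[1+k]≡x^[1+2k] n k) ⟩
    D d * n ^ suc (2 * k) * B
      ∎
    where
    k!^3≤a!*b!*r! : (k !) ^ 3 ≤ a ! * (b ! * (r ! * 1))
    k!^3≤a!*b!*r! = *-mono-≤ (!-mono-≤ k≤a) (*-mono-≤ (!-mono-≤ k≤b) (*-mono-≤ (!-mono-≤ k≤r) ≤-refl))
    regroup : ∀ e! nk dd nk′ mr! a! b! r! →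
      e! * nk * (dd * nk′ * mr!) * (a! * (b! * (r! * 1))) ≡ dd * (nk * nk′) * (b! * r! * mr! * a! * e!)
    regroup = solve-∀

  g*k!^3≤G*n^[1+2k] : g n s t m r * (k !) ^ 3 ≤ g n d d d 0 * n ^ suc (2 * k)
  g*k!^3≤G*n^[1+2k] = *-cancelʳ-≤ _ _ ((n ∸ d) ! * B) {{m*n≢0 _ _ {{(n ∸ d) !≢0}} {{B≢0}}}} (begin
    g n s t m r * K * (F * B)             ≡⟨ x*y*[z*w]≡x*w*[z*y] (g n s t m r) K F B ⟩
    g n s t m r * B * (F * K)             ≡⟨ cong (_* (F * K)) (g-closed s≤n m≤s r≤m a≤n∸s) ⟩
    n ! * D s * (t ∸ r) ! * (F * K)       ≡⟨ x*y*z*[w*v]≡x*[w*[y*z]*v] (n !) (D s) ((t ∸ r) !) F K ⟩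
    n ! * (F * (D s * (t ∸ r) !) * K)     ≤⟨ *-monoʳ-≤ (n !) cleared ⟩
    n ! * (D d * N * B)                   ≡⟨ x*[y*z*w]≡x*y*z*w (n !) (D d) N B ⟩
    n ! * D d * N * B                     ≡⟨ cong (λ x → x * N * B) (g-diagonal d≤n) ⟨
    g n d d d 0 * F * N * B               ≡⟨ x*y*z*w≡x*z*[y*w] (g n d d d 0) F N B ⟩
    g n d d d 0 * N * (F * B)             ∎)
    where
    K = (k !) ^ 3
    F = (n ∸ d) !
    N = n ^ suc (2 * k)
    s≤n : s ≤ n
    s≤n = ≤-trans (m≤m+n s t) s+t≤n
    a≤n∸s : a ≤ n ∸ s
    a≤n∸s = m+n≤o⇒m≤o∸n a (≤-trans (≤-reflexive (+-comm a s)) (≤-trans (+-monoʳ-≤ s (m∸n≤m t m)) s+t≤n))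
    B≢0 : NonZero B
    B≢0 = >-nonZero (*-mono-≤ (*-mono-≤ (*-mono-≤ (*-mono-≤ (1≤n! b) (1≤n! r)) (1≤n! (m ∸ r))) (1≤n! a))
                              (1≤n! (n ∸ s ∸ a)))
    x*y*[z*w]≡x*w*[z*y] : ∀ x y z w → x * y * (z * w) ≡ x * w * (z * y)
    x*y*[z*w]≡x*w*[z*y] = solve-∀
    x*y*z*[w*v]≡x*[w*[y*z]*v] : ∀ x y z w v → x * y * z * (w * v) ≡ x * (w * (y * z) * v)
    x*y*z*[w*v]≡x*[w*[y*z]*v] = solve-∀
    x*y*z*w≡x*z*[y*w] : ∀ x y z w → x * y * z * w ≡ x * z * (y * w)
    x*y*z*w≡x*z*[y*w] = solve-∀

[m*n]^o≡m^o*n^o : ∀ m n o → (m * n) ^ o ≡ m ^ o * n ^ o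
[m*n]^o≡m^o*n^o m n zero    = refl
[m*n]^o≡m^o*n^o m n (suc o) = begin
  m * n * (m * n) ^ o         ≡⟨ cong (m * n *_) ([m*n]^o≡m^o*n^o m n o) ⟩
  m * n * (m ^ o * n ^ o)     ≡⟨ interchange m n (m ^ o) (n ^ o) ⟩
  m * m ^ o * (n * n ^ o)     ∎
  where open ≡-Reasoning

[m^n]^o≡[m^o]^n : ∀ m n o → (m ^ n) ^ o ≡ (m ^ o) ^ n
[m^n]^o≡[m^o]^n m n o = begin
  (m ^ n) ^ o   ≡⟨ ^-*-assoc m n o ⟩
  m ^ (n * o)   ≡⟨ cong (m ^_) (*-comm n o) ⟩
  m ^ (o * n)   ≡⟨ ^-*-assoc m o n ⟨
  (m ^ o) ^ n   ∎
  where open ≡-Reasoning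

m^n≤m^m*n! : ∀ m n → .{{NonZero m}} → m ^ n ≤ m ^ m * n !
m^n≤m^m*n! m zero    = ≤-trans (m^n>0 m m) (≤-reflexive (sym (*-identityʳ (m ^ m))))
m^n≤m^m*n! m (suc n) with suc n ≤? m
... | yes 1+n≤m = begin
  m ^ suc n            ≤⟨ ^-monoʳ-≤ m 1+n≤m ⟩
  m ^ m                ≤⟨ m≤m*n (m ^ m) (suc n !) {{suc n !≢0}} ⟩
  m ^ m * suc n !      ∎
  where open ≤-Reasoning
... | no  1+n≰m = begin
  m * m ^ n                ≤⟨ *-mono-≤ (<⇒≤ (≰⇒> 1+n≰m)) (m^n≤m^m*n! m n) ⟩
  suc n * (m ^ m * n !)    ≡⟨ x∙yz≈y∙xz (suc n) (m ^ m) (n !) ⟩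
  m ^ m * (suc n * n !)    ∎
  where open ≤-Reasoning

n*n≤2^n : ∀ {n} → 4 ≤ n → n * n ≤ 2 ^ n
n*n≤2^n = go ∘ ≤⇒≤′
  where
  open ≤-Reasoning
  go : ∀ {n} → 4 ≤′ n → n * n ≤ 2 ^ n
  go ≤′-refl = ≤-refl
  go {suc n} (≤′-step 4≤′n) = begin
    suc n * suc n          ≡⟨ [1+x]*[1+x]≡x*x+[x+x+1] n ⟩
    n * n + (n + n + 1)    ≤⟨ +-monoʳ-≤ (n * n) 2n+1≤n*n ⟩
    n * n + n * n          ≤⟨ +-mono-≤ (go 4≤′n) (go 4≤′n) ⟩
    2 ^ n + 2 ^ n          ≡⟨ cong (2 ^ n +_) (+-identityʳ (2 ^ n)) ⟨
    2 ^ suc n              ∎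
    where
    4≤n : 4 ≤ n
    4≤n = ≤′⇒≤ 4≤′n
    [1+x]*[1+x]≡x*x+[x+x+1] : ∀ x → suc x * suc x ≡ x * x + (x + x + 1)
    [1+x]*[1+x]≡x*x+[x+x+1] = solve-∀
    2n+1≤n*n : n + n + 1 ≤ n * n
    2n+1≤n*n = begin
      n + n + 1    ≤⟨ +-monoʳ-≤ (n + n) (≤-trans (s≤s z≤n) 4≤n) ⟩
      n + n + n    ≡⟨ x+x+x≡3*x n ⟩
      3 * n        ≤⟨ *-monoˡ-≤ n (≤-trans (n≤1+n 3) 4≤n) ⟩
      n * n        ∎
      where
      x+x+x≡3*x : ∀ x → x + x + x ≡ 3 * x
      x+x+x≡3*x = solve-∀

^-bracket : ∀ {b} → 1 < b → ∀ {n} → 0 < n → ∃[ i ] n ≤ b ^ i × b ^ i ≤ b * n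
^-bracket {b} 1<b {suc zero}    _ = 0 , ≤-refl , ≤-trans (<⇒≤ 1<b) (m≤m*n b 1)
^-bracket {b} 1<b {suc (suc n)} _ with i , 1+n≤b^i , b^i≤b*[1+n] ← ^-bracket 1<b {suc n} (s≤s z≤n)
                                  with suc (suc n) ≤? b ^ i
... | yes 2+n≤b^i = i , 2+n≤b^i , ≤-trans b^i≤b*[1+n] (*-monoʳ-≤ b (n≤1+n (suc n)))
... | no  2+n≰b^i = suc i , 2+n≤b*b^i , *-monoʳ-≤ b (≤-trans (≤-pred (≰⇒> 2+n≰b^i)) (n≤1+n (suc n)))
  where
  open ≤-Reasoning
  instance
    b≢0 : NonZero b
    b≢0 = >-nonZero (<-trans (s≤s z≤n) 1<b)
  2+n≤b*b^i : suc (suc n) ≤ b * b ^ i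
  2+n≤b*b^i = begin
    suc (suc n)       ≤⟨ s≤s 1+n≤b^i ⟩
    1 + b ^ i         ≤⟨ +-monoˡ-≤ (b ^ i) (m^n>0 b i) ⟩
    b ^ i + b ^ i     ≡⟨ cong (b ^ i +_) (+-identityʳ (b ^ i)) ⟨
    2 * b ^ i         ≤⟨ *-monoˡ-≤ (b ^ i) 1<b ⟩
    b * b ^ i         ∎

n^[1+2k]/k!^3-subexponential : ∀ q → ∃[ N ] ∀ n → N ≤ n →
  ∃[ M ] M ^ q ≤ 2 ^ n × ∀ k → n ^ suc (2 * k) ≤ M * (k !) ^ 3
n^[1+2k]/k!^3-subexponential q = 8 ^ I , bound
  where
  I = 72 * q + 4
  bound : ∀ n → 8 ^ I ≤ n → ∃[ M ] M ^ q ≤ 2 ^ n × ∀ k → n ^ suc (2 * k) ≤ M * (k !) ^ 3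
  bound n 8^I≤n with i , n≤8^i , 8^i≤8*n ← ^-bracket (s≤s (s≤s z≤n)) (≤-trans (m^n>0 8 I) 8^I≤n) =
    n * (c ^ c) ^ 3 , M^q≤2^n , n^[1+2k]≤M*k!^3
    where
    open ≤-Reasoning
    -- c ≈ n^(2/3): large enough that n² ≤ c³, small enough that c^c is 2^O(n^(2/3) log n).
    c = 4 ^ i
    instance
      c≢0 : NonZero c
      c≢0 = m^n≢0 4 i
    I≤i : I ≤ i
    I≤i = ≮⇒≥ (λ i<I → <⇒≱ (^-monoʳ-< 8 (s≤s (s≤s z≤n)) i<I) (≤-trans 8^I≤n n≤8^i))

    n^2≤c^3 : n ^ 2 ≤ c ^ 3
    n^2≤c^3 = begin
      n ^ 2          ≤⟨ ^-monoˡ-≤ 2 n≤8^i ⟩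
      (8 ^ i) ^ 2    ≡⟨ [m^n]^o≡[m^o]^n 8 i 2 ⟩
      (4 ^ 3) ^ i    ≡⟨ [m^n]^o≡[m^o]^n 4 3 i ⟩
      c ^ 3          ∎

    n^[1+2k]≤M*k!^3 : ∀ k → n ^ suc (2 * k) ≤ n * (c ^ c) ^ 3 * (k !) ^ 3
    n^[1+2k]≤M*k!^3 k = begin
      n ^ suc (2 * k)                  ≡⟨ cong (n *_) (^-*-assoc n 2 k) ⟨
      n * (n ^ 2) ^ k                  ≤⟨ *-monoʳ-≤ n (^-monoˡ-≤ k n^2≤c^3) ⟩
      n * (c ^ 3) ^ k                  ≡⟨ cong (n *_) ([m^n]^o≡[m^o]^n c 3 k) ⟩
      n * (c ^ k) ^ 3                  ≤⟨ *-monoʳ-≤ n (^-monoˡ-≤ 3 (m^n≤m^m*n! c k)) ⟩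
      n * (c ^ c * k !) ^ 3            ≡⟨ cong (n *_) ([m*n]^o≡m^o*n^o (c ^ c) (k !) 3) ⟩
      n * ((c ^ c) ^ 3 * (k !) ^ 3)    ≡⟨ *-assoc n ((c ^ c) ^ 3) ((k !) ^ 3) ⟨
      n * (c ^ c) ^ 3 * (k !) ^ 3      ∎

    M≤2^[9ic] : n * (c ^ c) ^ 3 ≤ 2 ^ (9 * i * c)
    M≤2^[9ic] = begin
      n * (c ^ c) ^ 3                           ≤⟨ *-monoˡ-≤ ((c ^ c) ^ 3) n≤8^i ⟩
      8 ^ i * (c ^ c) ^ 3                       ≡⟨ cong₂ _*_ (^-*-assoc 2 3 i) [c^c]^3≡2^[2ic*3] ⟩
      2 ^ (3 * i) * 2 ^ (2 * i * c * 3)         ≤⟨ *-monoˡ-≤ (2 ^ (2 * i * c * 3)) (^-monoʳ-≤ 2 (m≤m*n (3 * i) c)) ⟩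
      2 ^ (3 * i * c) * 2 ^ (2 * i * c * 3)     ≡⟨ ^-distribˡ-+-* 2 (3 * i * c) (2 * i * c * 3) ⟨
      2 ^ (3 * i * c + 2 * i * c * 3)           ≡⟨ cong (2 ^_) (3xy+2xy*3≡9xy i c) ⟩
      2 ^ (9 * i * c)                           ∎
      where
      [c^c]^3≡2^[2ic*3] : (c ^ c) ^ 3 ≡ 2 ^ (2 * i * c * 3)
      [c^c]^3≡2^[2ic*3] = trans (cong (λ x → (x ^ c) ^ 3) (^-*-assoc 2 2 i))
                            (trans (cong (_^ 3) (^-*-assoc 2 (2 * i) c)) (^-*-assoc 2 (2 * i * c) 3))
      3xy+2xy*3≡9xy : ∀ x y → 3 * x * y + 2 * x * y * 3 ≡ 9 * x * y
      3xy+2xy*3≡9xy = solve-∀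

    9ic*q≤n : 9 * i * c * q ≤ n
    9ic*q≤n = *-cancelˡ-≤ 8 (begin
      8 * (9 * i * c * q)     ≡⟨ 8*[9xyz]≡72*z*x*y i c q ⟩
      72 * q * i * c          ≤⟨ *-monoˡ-≤ c (≤-trans (*-monoˡ-≤ i 72q≤i) (n*n≤2^n 4≤i)) ⟩
      2 ^ i * c               ≡⟨ [m*n]^o≡m^o*n^o 2 4 i ⟨
      8 ^ i                   ≤⟨ 8^i≤8*n ⟩
      8 * n                   ∎)
      where
      72q≤i : 72 * q ≤ i
      72q≤i = ≤-trans (m≤m+n (72 * q) 4) I≤i
      4≤i : 4 ≤ i
      4≤i = ≤-trans (m≤n+m 4 (72 * q)) I≤i
      8*[9xyz]≡72*z*x*y : ∀ x y z → 8 * (9 * x * y * z) ≡ 72 * z * x * y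
      8*[9xyz]≡72*z*x*y = solve-∀

    M^q≤2^n : (n * (c ^ c) ^ 3) ^ q ≤ 2 ^ n
    M^q≤2^n = begin
      (n * (c ^ c) ^ 3) ^ q     ≤⟨ ^-monoˡ-≤ q M≤2^[9ic] ⟩
      (2 ^ (9 * i * c)) ^ q     ≡⟨ ^-*-assoc 2 (9 * i * c) q ⟩
      2 ^ (9 * i * c * q)       ≤⟨ ^-monoʳ-≤ 2 9ic*q≤n ⟩
      2 ^ n                     ∎

2*[x^x*y^y]≤[x+y]^[x+y] : ∀ {x y} → 1 ≤ x → x ≤ y → 2 * (x ^ x * y ^ y) ≤ (x + y) ^ (x + y)
2*[x^x*y^y]≤[x+y]^[x+y] {x} {y} 1≤x x≤y = begin
  2 * (x ^ x * y ^ y)          ≤⟨ *-monoˡ-≤ (x ^ x * y ^ y) (^-monoʳ-≤ 2 1≤x) ⟩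
  2 ^ x * (x ^ x * y ^ y)      ≡⟨ *-assoc (2 ^ x) (x ^ x) (y ^ y) ⟨
  2 ^ x * x ^ x * y ^ y        ≡⟨ cong (_* y ^ y) ([m*n]^o≡m^o*n^o 2 x x) ⟨
  (2 * x) ^ x * y ^ y          ≤⟨ *-mono-≤ (^-monoˡ-≤ x 2x≤x+y) (^-monoˡ-≤ y (m≤n+m y x)) ⟩
  (x + y) ^ x * (x + y) ^ y    ≡⟨ ^-distribˡ-+-* (x + y) x y ⟨
  (x + y) ^ (x + y)            ∎
  where
  open ≤-Reasoning
  2x≤x+y : 2 * x ≤ x + y
  2x≤x+y = +-monoʳ-≤ x (≤-trans (≤-reflexive (+-identityʳ x)) x≤y)

-- With W = (3p)^(3p) (q ∸ 3p)^(q ∸ 3p) = q^q 2^(-q h₂(3p/q)), this says q h₂(3p/q) ≥ 1.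
2*[3p]^[3p]*[q∸3p]^[q∸3p]≤q^q : ∀ {p q} → 0 < p → 6 * p < q →
  2 * ((3 * p) ^ (3 * p) * (q ∸ 3 * p) ^ (q ∸ 3 * p)) ≤ q ^ q
2*[3p]^[3p]*[q∸3p]^[q∸3p]≤q^q {p} {q} 0<p 6p<q =
  subst (λ z → 2 * ((3 * p) ^ (3 * p) * (q ∸ 3 * p) ^ (q ∸ 3 * p)) ≤ z ^ z) (m+[n∸m]≡n 3p≤q)
    (2*[x^x*y^y]≤[x+y]^[x+y] (≤-trans 0<p (m≤n*m p 3)) (m+n≤o⇒m≤o∸n (3 * p) 3p+3p≤q))
  where
  3p+3p≤q : 3 * p + 3 * p ≤ q
  3p+3p≤q = ≤-trans (≤-reflexive (3x+3x≡6x p)) (<⇒≤ 6p<q)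
    where
    3x+3x≡6x : ∀ x → 3 * x + 3 * x ≡ 6 * x
    3x+3x≡6x = solve-∀
  3p≤q : 3 * p ≤ q
  3p≤q = ≤-trans (m≤m+n (3 * p) (3 * p)) 3p+3p≤q

x^q*w^e≤y^q*z^e : ∀ {x y M w z} q {n e} → x ≤ y * M → M ^ q ≤ 2 ^ n → 2 * w ≤ z → n ≤ e →
  x ^ q * w ^ e ≤ y ^ q * z ^ e
x^q*w^e≤y^q*z^e {x} {y} {M} {w} {z} q {n} {e} x≤y*M M^q≤2^n 2w≤z n≤e = begin
  x ^ q * w ^ e              ≤⟨ *-monoˡ-≤ (w ^ e) (^-monoˡ-≤ q x≤y*M) ⟩
  (y * M) ^ q * w ^ e        ≡⟨ cong (_* w ^ e) ([m*n]^o≡m^o*n^o y M q) ⟩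
  y ^ q * M ^ q * w ^ e      ≤⟨ *-monoˡ-≤ (w ^ e) (*-monoʳ-≤ (y ^ q) (≤-trans M^q≤2^n (^-monoʳ-≤ 2 n≤e))) ⟩
  y ^ q * 2 ^ e * w ^ e      ≡⟨ *-assoc (y ^ q) (2 ^ e) (w ^ e) ⟩
  y ^ q * (2 ^ e * w ^ e)    ≡⟨ cong (y ^ q *_) ([m*n]^o≡m^o*n^o 2 w e) ⟨
  y ^ q * (2 * w) ^ e        ≤⟨ *-monoʳ-≤ (y ^ q) (^-monoˡ-≤ e 2w≤z) ⟩
  y ^ q * z ^ e              ∎
  where open ≤-Reasoning

b*d≡a*n⇒d+d<n : ∀ {a b d n} → 2 * a < b → 0 < d → b * d ≡ a * n → d + d < n
b*d≡a*n⇒d+d<n {a} {b} {d} {n} 2a<b 0<d b*d≡a*n = ≰⇒> λ n≤d+d → <-irrefl refl (begin-strict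
  b * (d + d)          ≡⟨ *-distribˡ-+ b d d ⟩
  b * d + b * d        ≡⟨ cong₂ _+_ b*d≡a*n b*d≡a*n ⟩
  a * n + a * n        ≡⟨ x*y+x*y≡2*x*y a n ⟩
  2 * a * n            ≤⟨ *-monoʳ-≤ (2 * a) n≤d+d ⟩
  2 * a * (d + d)      <⟨ *-monoˡ-< (d + d) {{>-nonZero (≤-trans 0<d (m≤m+n d d))}} 2a<b ⟩
  b * (d + d)          ∎)
  where
  open ≤-Reasoning
  x*y+x*y≡2*x*y : ∀ x y → x * y + x * y ≡ 2 * x * y
  x*y+x*y≡2*x*y = solve-∀

g≤G*M : ∀ {n d s t m r M} → 1 ≤ s → s ≤ d → t ≤ d → m ≤ s ⊓ t → ceilPos s t m d ≤ r → r ≤ m →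
  d + d ≤ n → (∀ k → n ^ suc (2 * k) ≤ M * (k !) ^ 3) → g n s t m r ≤ g n d d d 0 * M
g≤G*M {n} {suc d′} {suc s′} {t} {m} {r} {M} (s≤s z≤n) s≤d t≤d m≤s⊓t k≤r r≤m d+d≤n n^[1+2k]≤M*k!^3 =
  *-cancelʳ-≤ _ _ ((k !) ^ 3) {{m^n≢0 (k !) 3 {{k !≢0}}}} (begin
    g n s t m r * (k !) ^ 3              ≤⟨ g*k!^3≤G*n^[1+2k] ⟩
    g n d d d 0 * n ^ suc (2 * k)        ≤⟨ *-monoʳ-≤ (g n d d d 0) (n^[1+2k]≤M*k!^3 k) ⟩
    g n d d d 0 * (M * (k !) ^ 3)        ≡⟨ *-assoc (g n d d d 0) M ((k !) ^ 3) ⟨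
    g n d d d 0 * M * (k !) ^ 3          ∎)
  where
  open ≤-Reasoning
  s = suc s′
  d = suc d′
  k = (s + t) ∸ (m + d)
  open Estimate s≤d t≤d (m≤n⊓o⇒m≤n s t m≤s⊓t) (m≤n⊓o⇒m≤o s t m≤s⊓t) r≤m k≤r
    (≤-trans (+-mono-≤ s≤d t≤d) d+d≤n) (≤-trans (m≤m+n d d) d+d≤n)
    using (g*k!^3≤G*n^[1+2k])

lemma7 : (a b : ℕ) → 0 < a → 2 * a < b →
    (p q : ℕ) → 0 < p → 6 * p < q →
    Σ ℕ λ N → (n d : ℕ) → N ≤ n → b * d ≡ a * n →
      (s t m r : ℕ) →
      1 ≤ s → s ≤ d → 1 ≤ t → t ≤ d →
      ceilHalf⁺ s t d ≤ m → m ≤ s ⊓ t →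
      ceilPos s t m d ≤ r → r ≤ m →
      g n s t m r ^ q * ((3 * p) ^ (3 * p) * (q ∸ 3 * p) ^ (q ∸ 3 * p)) ^ (3 * n)
        ≤ g n d d d 0 ^ q * (q ^ q) ^ (3 * n)
lemma7 a b _ 2a<b p q 0<p 6p<q =
  let N , subexponential = n^[1+2k]/k!^3-subexponential q in
  N , λ n d N≤n b*d≡a*n s t m r 1≤s s≤d _ t≤d _ m≤s⊓t k≤r r≤m →
    let M , M^q≤2^n , n^[1+2k]≤M*k!^3 = subexponential n N≤n
        d+d<n = b*d≡a*n⇒d+d<n {a} {b} {d} {n} 2a<b (≤-trans 1≤s s≤d) b*d≡a*n
    in  x^q*w^e≤y^q*z^e q
          (g≤G*M 1≤s s≤d t≤d m≤s⊓t k≤r r≤m (<⇒≤ d+d<n) n^[1+2k]≤M*k!^3)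
          M^q≤2^n (2*[3p]^[3p]*[q∸3p]^[q∸3p]≤q^q 0<p 6p<q) (m≤n*m n 3)
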